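{- Let $m\geq 3$ and let $G$ be the tree on the $m+3$ vertices $o,x_1,\dots,x_m,y,z$ whose edges are $ox_1,\dots,ox_m$, $x_1y$ and $x_1z$. Let $H$ be a distance-balanced graph which contains $G$ as a spanning subgraph. Then $\mathrm{diam}(H)\leq 2$, and hence $H$ is a regular graph. Moreover, $b(G)=\frac{m^2+m-4}{2}$.
   Context: All graphs are finite and simple. For vertices $u,v$ of a graph $H$, $d_H(u,v)$ is the length of a shortest $u$–$v$ path, and $\mathrm{diam}(H)=\max_{u,v} d_H(u,v)$. For an edge $xy$ of $H$, $W^H_{xy}=\{u\in V(H): d_H(u,x)<d_H(u,y)\}$. A graph $H$ is distance-balanced if $|W^H_{xy}|=|W^H_{yx}|$ for every edge $xy$ of $H$. For a graph $G$, $b(G)$ is the smallest number of edges which can be added to $G$ (keeping the vertex set) so that the resulting graph is distance-balanced. -}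

module Defs where

open import Data.Bool using (Bool; true; false; _∧_; _∨_; if_then_else_)
open import Data.Nat using (ℕ; zero; suc; _+_; _*_; _≤_; _<_; _<ᵇ_; _≡ᵇ_; _≤ᵇ_)
open import Data.Nat.Properties using (_<?_)
open import Data.Fin using (Fin; toℕ)
open import Data.List using (List; length; filter; map; allFin)
open import Data.Nat.ListAction using (sum)
open import Data.Bool.ListAction using (any)
open import Data.Product using (Σ; _×_; ∃)
open import Relation.Binary.PropositionalEquality using (_≡_)

Adj : ℕ → Set
Adj n = Fin n → Fin n → Bool

record Graph (n : ℕ) : Set where
  field
    adj    : Adj n
    sym    : ∀ u v → adj u v ≡ adj v u
    irrefl : ∀ u → adj u u ≡ false
open Graph public

module _ {n : ℕ} (A : Adj n) where
  within : ℕ → Fin n → Fin n → Bool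
  within zero    u v = toℕ u ≡ᵇ toℕ v
  within (suc k) u v = within k u v ∨ any (λ w → A u w ∧ within k w v) (allFin n)

  -- least k (searching k = 0,1,...) with a walk of length ≤ k; fallback value
  -- is returned only when v is unreachable from u (never for connected graphs)
  search : ℕ → ℕ → Fin n → Fin n → ℕ
  search zero    k u v = k
  search (suc f) k u v = if within k u v then k else search f (suc k) u v

  dist : Fin n → Fin n → ℕ
  dist u v = search n 0 u v

  Wcard : Fin n → Fin n → ℕ
  Wcard x y = length (filter (λ u → dist u x <? dist u y) (allFin n))

  degree : Fin n → ℕ
  degree v = sum (map (λ w → if A v w then 1 else 0) (allFin n))

  edgeCount : ℕ
  edgeCount = sum (map (λ u → sum (map (λ v → if (toℕ u <ᵇ toℕ v) ∧ A u v then 1 else 0)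
                                        (allFin n))) (allFin n))

DistanceBalanced : ∀ {n} → Graph n → Set
DistanceBalanced H = ∀ x y → adj H x y ≡ true → Wcard (adj H) x y ≡ Wcard (adj H) y x

DiamAtMost : ∀ {n} → Graph n → ℕ → Set
DiamAtMost H k = ∀ u v → dist (adj H) u v ≤ k

Regular : ∀ {n} → Graph n → Set
Regular {n} H = ∃ λ r → ∀ v → degree (adj H) v ≡ r

SpanningSuper : ∀ {n} → Adj n → Graph n → Set
SpanningSuper A H = ∀ u v → A u v ≡ true → adj H u v ≡ true

BalanceNumberIs : ∀ {n} → Adj n → ℕ → Set
BalanceNumberIs {n} A N =
  (Σ (Graph n) λ H → SpanningSuper A H × DistanceBalanced H × edgeCount (adj H) ≡ edgeCount A + N)
  × (∀ (H : Graph n) → SpanningSuper A H → DistanceBalanced H → edgeCount A + N ≤ edgeCount (adj H))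

-- The tree G on Fin (m + 3): o = 0, y = 1, z = 2, x_i = i + 2 (so x_1 = 3, ..., x_m = m + 2).
-- Edges: o x_i (1 ≤ i ≤ m), x_1 y, x_1 z.
treeEdge : ℕ → ℕ → Bool
treeEdge a b = ((a ≡ᵇ 0) ∧ (3 ≤ᵇ b)) ∨ ((a ≡ᵇ 3) ∧ ((b ≡ᵇ 1) ∨ (b ≡ᵇ 2)))

treeAdj : (m : ℕ) → Adj (m + 3)
treeAdj m u v = treeEdge (toℕ u) (toℕ v) ∨ treeEdge (toℕ v) (toℕ u)

-- For an edge xy every vertex u has |d(u,x) - d(u,y)| <= 1, whence Tr(x) + |W_xy| = Tr(y) + |W_yx|
-- for the transmission Tr(v) = sum_u d(u,v): a graph is distance-balanced iff Tr is constant along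
-- edges, hence constant when the graph is connected. The weight d(u,v) + [u ~ v] + 2[u = v] is
-- >= 2, with equality iff d(u,v) <= 2; summing it over u gives Tr(v) + deg(v) + 2 >= 2n, with
-- equality when v has eccentricity <= 2. In a distance-balanced H containing G the vertex o has eccentricity <= 2 and
-- degree >= m, so every vertex has degree >= deg(o) >= m. Two vertices at distance > 2 have disjoint
-- closed neighbourhoods, which would force 2m + 2 <= m + 3; so diam(H) <= 2, and then every vertex
-- attains equality above, making deg(v) = 2n - 2 - Tr(v) constant. Thus H has at least (m+3)m/2
-- edges, and this is attained: the complement of a triangle on {o, y, z} together with an m-cycle on
-- the x_i contains G, is m-regular of diameter 2, and is therefore distance-balanced.

module Submission where

open import Data.Bool using (Bool; true; false; _∧_; _∨_; not; if_then_else_; T)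
open import Data.Bool.ListAction using (any)
open import Data.Bool.Properties using (∨-zeroʳ; ∨-identityʳ; ∨-comm; ∧-identityʳ; ∧-zeroʳ; ∧-comm)
open import Data.Empty using (⊥; ⊥-elim)
open import Data.Fin as Fin using (Fin; zero; suc; toℕ)
open import Data.Fin.Properties using (toℕ-injective; toℕ-fromℕ<; toℕ<n)
open import Data.List using ([]; _∷_; length; filter; map; allFin; tabulate)
open import Data.List.Properties using (map-tabulate)
open import Data.Nat using (ℕ; zero; suc; pred; >-nonZero; _+_; _*_; _∸_; _≤_; _<_; z≤n; s≤s; _<ᵇ_; _≡ᵇ_; _≤ᵇ_)
open import Data.Nat.DivMod using (_/_; m*n/n≡m)
open import Data.Nat.ListAction using (sum)
open import Data.Nat.Properties
open import Data.Nat.Tactic.RingSolver using (solve; solve-∀)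
open import Algebra.Properties.CommutativeMonoid.Sum +-0-commutativeMonoid
  using (sum-syntax; sum-cong-≗; sum-replicate-zero; ∑-distrib-+; ∑-comm)
open import Data.Product using (Σ; _×_; _,_)
open import Data.Sum using (_⊎_; inj₁; inj₂)
open import Function.Bundles using (mk⇔)
open import Relation.Binary.Definitions using (tri<; tri≈; tri>)
open import Relation.Binary.PropositionalEquality
open import Relation.Nullary using (¬_; Dec; yes; no; does; ofʸ; ofⁿ)
open import Relation.Nullary.Decidable using (dec-true; dec-false; does-⇔)

open import Defs hiding (sym; irrefl)

𝟙 : Bool → ℕ
𝟙 b = if b then 1 else 0

true≢false : ∀ {b} → b ≡ true → b ≡ false → ⊥
true≢false refl ()

∧-true⁻ : ∀ {a b} → a ∧ b ≡ true → a ≡ true × b ≡ true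
∧-true⁻ {true} b≡true = refl , b≡true

any-tabulate : ∀ {X : Set} {n} (f : Fin n → X) (p : X → Bool) i → p (f i) ≡ true → any p (tabulate f) ≡ true
any-tabulate f p zero    h rewrite h = refl
any-tabulate f p (suc i) h = trans (cong (p (f zero) ∨_) (any-tabulate (λ j → f (suc j)) p i h)) (∨-zeroʳ _)

any-true⁻ : ∀ {X : Set} (p : X → Bool) xs → any p xs ≡ true → Σ X λ x → p x ≡ true
any-true⁻ p (x ∷ xs) h with p x in px
... | true  = x , px
... | false = any-true⁻ p xs h

𝟙-partition : ∀ {P Q R : Set} (p : Dec P) (q : Dec Q) (r : Dec R) → (P → ¬ Q) → (P → ¬ R) → (Q → ¬ R) →
  𝟙 (not (does p ∨ (does q ∨ does r))) + (𝟙 (does p) + 𝟙 (does q) + 𝟙 (does r)) ≡ 1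
𝟙-partition (yes p) (yes q) _       p⇒¬q _    _    = ⊥-elim (p⇒¬q p q)
𝟙-partition (yes p) (no _)  (yes r) _    p⇒¬r _    = ⊥-elim (p⇒¬r p r)
𝟙-partition (yes _) (no _)  (no _)  _    _    _    = refl
𝟙-partition (no _)  (yes q) (yes r) _    _    q⇒¬r = ⊥-elim (q⇒¬r q r)
𝟙-partition (no _)  (yes _) (no _)  _    _    _    = refl
𝟙-partition (no _)  (no _)  (yes _) _    _    _    = refl
𝟙-partition (no _)  (no _)  (no _)  _    _    _    = refl

+𝟙<-swap : ∀ {a b} → a ≤ suc b → b ≤ suc a → a + 𝟙 (does (a <? b)) ≡ b + 𝟙 (does (b <? a))
+𝟙<-swap {a} {b} a≤1+b b≤1+a with <-cmp a b
... | tri< a<b _ _ rewrite dec-true (a <? b) a<b | dec-false (b <? a) (<-asym a<b)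
                          | ≤-antisym b≤1+a a<b = trans (+-comm a 1) (sym (+-identityʳ (suc a)))
... | tri≈ _ refl _ = refl
... | tri> _ _ b<a rewrite dec-false (a <? b) (<-asym b<a) | dec-true (b <? a) b<a
                          | ≤-antisym a≤1+b b<a = trans (+-identityʳ (suc b)) (+-comm 1 b)

+-double : ∀ a → a + a ≡ a * 2
+-double = solve-∀

sum-map-allFin : ∀ {n} (f : Fin n → ℕ) → sum (map f (allFin n)) ≡ ∑[ i < n ] f i
sum-map-allFin {n} f = trans (cong sum (map-tabulate {n = n} (λ i → i) f)) (sum-tabulate f)
  where
  sum-tabulate : ∀ {n} (g : Fin n → ℕ) → sum (tabulate g) ≡ ∑[ i < n ] g i
  sum-tabulate {zero}  g = refl
  sum-tabulate {suc n} g = cong (g zero +_) (sum-tabulate (λ i → g (suc i)))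

∑-mono-≤ : ∀ {n} {f g : Fin n → ℕ} → (∀ i → f i ≤ g i) → ∑[ i < n ] f i ≤ ∑[ i < n ] g i
∑-mono-≤ {zero}  f≤g = z≤n
∑-mono-≤ {suc n} f≤g = +-mono-≤ (f≤g zero) (∑-mono-≤ (λ i → f≤g (suc i)))

∑-const : ∀ n c → ∑[ i < n ] c ≡ n * c
∑-const zero    c = refl
∑-const (suc n) c = cong (c +_) (∑-const n c)

∑-1 : ∀ n → ∑[ i < n ] 1 ≡ n
∑-1 n = trans (∑-const n 1) (*-identityʳ n)

∑-zero : ∀ n {f : Fin n → ℕ} → (∀ i → f i ≡ 0) → ∑[ i < n ] f i ≡ 0
∑-zero n {f} f≡0 = trans (sum-cong-≗ {n} {f} {λ _ → 0} f≡0) (sum-replicate-zero n)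

∑-𝟙-≡ᵇ : ∀ {n c} → c < n → ∑[ i < n ] 𝟙 (toℕ i ≡ᵇ c) ≡ 1
∑-𝟙-≡ᵇ {suc n} {zero}  _         = cong suc (∑-zero n (λ _ → refl))
∑-𝟙-≡ᵇ {suc n} {suc c} (s≤s c<n) = ∑-𝟙-≡ᵇ c<n

δ : ∀ {n} → Fin n → Fin n → ℕ
δ u v = 𝟙 (does (u Fin.≟ v))

∑-δ : ∀ {n} (v : Fin n) → ∑[ u < n ] δ u v ≡ 1
∑-δ {suc n} zero    = cong suc (∑-zero n (λ _ → refl))
∑-δ         (suc v) = ∑-δ v

∑-split3 : ∀ m (f : ℕ → ℕ) →
  ∑[ i < m + 3 ] f (toℕ i) ≡ f 0 + (f 1 + (f 2 + ∑[ i < m ] f (3 + toℕ i)))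
∑-split3 m f rewrite +-comm m 3 = refl

length-filter-∑ : ∀ {n} {P : Fin n → Set} (P? : ∀ i → Dec (P i)) →
  length (filter P? (allFin n)) ≡ ∑[ i < n ] 𝟙 (does (P? i))
length-filter-∑ {n} P? = trans (length-filter (allFin n)) (sum-map-allFin (λ i → 𝟙 (does (P? i))))
  where
  length-filter : ∀ xs → length (filter P? xs) ≡ sum (map (λ i → 𝟙 (does (P? i))) xs)
  length-filter []       = refl
  length-filter (x ∷ xs) with does (P? x)
  ... | true  = cong suc (length-filter xs)
  ... | false = length-filter xs

module _ {n : ℕ} (A : Adj n) where

  within-refl : ∀ u → within A 0 u u ≡ true
  within-refl u = dec-true (toℕ u ≟ toℕ u) refl

  within-zero⁻ : ∀ u v → within A 0 u v ≡ true → u ≡ v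
  within-zero⁻ u v uv = toℕ-injective (≡ᵇ⇒≡ (toℕ u) (toℕ v) (subst T (sym uv) _))

  within-weaken : ∀ k u v → within A k u v ≡ true → within A (suc k) u v ≡ true
  within-weaken k u v uv = cong (_∨ any (λ w → A u w ∧ within A k w v) (allFin n)) uv

  within-step : ∀ k u w v → A u w ≡ true → within A k w v ≡ true → within A (suc k) u v ≡ true
  within-step k u w v uw wv =
    trans (cong (within A k u v ∨_) (any-tabulate (λ i → i) (λ x → A u x ∧ within A k x v) w (cong₂ _∧_ uw wv)))
          (∨-zeroʳ _)

  within-edge : ∀ u v → A u v ≡ true → within A 1 u v ≡ true
  within-edge u v uv = within-step 0 u v v uv (within-refl v)

  within-suc⁻ : ∀ k u v → within A (suc k) u v ≡ true →
    within A k u v ≡ true ⊎ Σ (Fin n) λ w → A u w ≡ true × within A k w v ≡ true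
  within-suc⁻ k u v h with within A k u v in uv
  ... | true  = inj₁ refl
  ... | false with any-true⁻ _ (allFin n) h
  ...   | w , uwv = inj₂ (w , ∧-true⁻ uwv)

  within-snoc : ∀ k u x y → within A k u x ≡ true → A x y ≡ true → within A (suc k) u y ≡ true
  within-snoc zero u x y ux xy with within-zero⁻ u x ux
  ... | refl = within-edge u y xy
  within-snoc (suc k) u x y ux xy with within-suc⁻ k u x ux
  ... | inj₁ ux′           = within-weaken (suc k) u y (within-snoc k u x y ux′ xy)
  ... | inj₂ (w , uw , wx) = within-step (suc k) u w y uw (within-snoc k w x y wx xy)

  search-≤-within : ∀ f k j u v → within A j u v ≡ true → k ≤ j → search A f k u v ≤ j
  search-≤-within zero    k j u v _  k≤j = k≤j
  search-≤-within (suc f) k j u v uv k≤j with within A k u v in e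
  ... | true  = k≤j
  ... | false with m≤n⇒m<n∨m≡n k≤j
  ...   | inj₁ k<j  = search-≤-within f (suc k) j u v uv k<j
  ...   | inj₂ refl = ⊥-elim (true≢false uv e)

  search-≤ : ∀ f k u v → search A f k u v ≤ k + f
  search-≤ zero    k u v = ≤-reflexive (sym (+-identityʳ k))
  search-≤ (suc f) k u v with within A k u v
  ... | true  = m≤m+n k (suc f)
  ... | false = ≤-trans (search-≤ f (suc k) u v) (≤-reflexive (sym (+-suc k f)))

  search-sound : ∀ f k u v → within A (search A f k u v) u v ≡ true ⊎ search A f k u v ≡ k + f
  search-sound zero    k u v = inj₂ (sym (+-identityʳ k))
  search-sound (suc f) k u v with within A k u v in e
  ... | true  = inj₁ e
  ... | false with search-sound f (suc k) u v
  ...   | inj₁ found     = inj₁ found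
  ...   | inj₂ exhausted = inj₂ (trans exhausted (sym (+-suc k f)))

  dist-≤ : ∀ k u v → within A k u v ≡ true → dist A u v ≤ k
  dist-≤ k u v uv = search-≤-within n 0 k u v uv z≤n

  dist-refl : ∀ u → dist A u u ≡ 0
  dist-refl u = n≤0⇒n≡0 (dist-≤ 0 u u (within-refl u))

  dist≡0⇒≡ : ∀ {u v} → dist A u v ≡ 0 → u ≡ v
  dist≡0⇒≡ {u} {v} d≡0 with search-sound n 0 u v
  ... | inj₁ found     = within-zero⁻ u v (subst (λ k → within A k u v ≡ true) d≡0 found)
  ... | inj₂ exhausted = ⊥-elim (Fin0-empty (subst Fin (trans (sym exhausted) d≡0) u))
    where
    Fin0-empty : Fin 0 → ⊥
    Fin0-empty ()

  -- 2 ≤ n excludes the fallback value dist = n = 1 for unreachable pairs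
  dist≡1⇒adj : 2 ≤ n → ∀ {u v} → dist A u v ≡ 1 → A u v ≡ true
  dist≡1⇒adj 2≤n {u} {v} d≡1 with search-sound n 0 u v
  ... | inj₂ exhausted = ⊥-elim (<⇒≢ 2≤n (trans (sym d≡1) exhausted))
  ... | inj₁ found with within-suc⁻ 0 u v (subst (λ k → within A k u v ≡ true) d≡1 found)
  ...   | inj₂ (w , uw , wv) rewrite within-zero⁻ w v wv = uw
  ...   | inj₁ uv with within-zero⁻ u v uv
  ...     | refl = ⊥-elim (0≢1+n (trans (sym (dist-refl u)) d≡1))

  -- if x is unreachable from u, dist A u x takes its maximal value n
  dist-edge : ∀ u {x y} → A x y ≡ true → dist A u y ≤ suc (dist A u x)
  dist-edge u {x} {y} xy with search-sound n 0 u x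
  ... | inj₁ found     = dist-≤ (suc (dist A u x)) u y (within-snoc (dist A u x) u x y found xy)
  ... | inj₂ exhausted = ≤-trans (search-≤ n 0 u y) (≤-trans (n≤1+n n) (s≤s (≤-reflexive (sym exhausted))))

within-⊆ : ∀ {n} (A B : Adj n) → (∀ u v → A u v ≡ true → B u v ≡ true) →
  ∀ k u v → within A k u v ≡ true → within B k u v ≡ true
within-⊆ A B A⊆B zero    u v uv = uv
within-⊆ A B A⊆B (suc k) u v uv with within-suc⁻ A k u v uv
... | inj₁ uv′           = within-weaken B k u v (within-⊆ A B A⊆B k u v uv′)
... | inj₂ (w , uw , wv) = within-step B k u w v (A⊆B u w uw) (within-⊆ A B A⊆B k w v wv)

degree-∑ : ∀ {n} (A : Adj n) v → degree A v ≡ ∑[ w < n ] 𝟙 (A v w)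
degree-∑ A v = sum-map-allFin (λ w → 𝟙 (A v w))

edgeCount-∑ : ∀ {n} (A : Adj n) → edgeCount A ≡ ∑[ u < n ] ∑[ v < n ] 𝟙 ((toℕ u <ᵇ toℕ v) ∧ A u v)
edgeCount-∑ {n} A = trans (sum-map-allFin (λ u → sum (map (E u) (allFin n)))) (sum-cong-≗ (λ u → sum-map-allFin (E u)))
  where
  E : Fin n → Fin n → ℕ
  E u v = 𝟙 ((toℕ u <ᵇ toℕ v) ∧ A u v)

degree-⊆ : ∀ {n} (A B : Adj n) → (∀ u v → A u v ≡ true → B u v ≡ true) → ∀ v → degree A v ≤ degree B v
degree-⊆ A B A⊆B v = subst₂ _≤_ (sym (degree-∑ A v)) (sym (degree-∑ B v)) (∑-mono-≤ 𝟙-mono)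
  where
  𝟙-mono : ∀ w → 𝟙 (A v w) ≤ 𝟙 (B v w)
  𝟙-mono w with A v w in vw
  ... | false = z≤n
  ... | true rewrite A⊆B v w vw = ≤-refl

module _ {n : ℕ} (G : Graph n) where

  private
    A : Adj n
    A = adj G

  transmission : Fin n → ℕ
  transmission v = ∑[ u < n ] dist A u v

  transmission+Wcard : ∀ {x y} → A x y ≡ true → transmission x + Wcard A x y ≡ transmission y + Wcard A y x
  transmission+Wcard {x} {y} xy = begin
    transmission x + Wcard A x y
      ≡⟨ cong (transmission x +_) (length-filter-∑ (λ u → dist A u x <? dist A u y)) ⟩
    transmission x + ∑[ u < n ] 𝟙 (does (dist A u x <? dist A u y))
      ≡⟨ ∑-distrib-+ (λ u → dist A u x) _ ⟨
    ∑[ u < n ] (dist A u x + 𝟙 (does (dist A u x <? dist A u y)))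
      ≡⟨ sum-cong-≗ (λ u → +𝟙<-swap (dist-edge A u yx) (dist-edge A u xy)) ⟩
    ∑[ u < n ] (dist A u y + 𝟙 (does (dist A u y <? dist A u x)))
      ≡⟨ ∑-distrib-+ (λ u → dist A u y) _ ⟩
    transmission y + ∑[ u < n ] 𝟙 (does (dist A u y <? dist A u x))
      ≡⟨ cong (transmission y +_) (length-filter-∑ (λ u → dist A u y <? dist A u x)) ⟨
    transmission y + Wcard A y x ∎
    where
    open ≡-Reasoning
    yx : A y x ≡ true
    yx = trans (Graph.sym G y x) xy

  balanced⇒transmission-edge : DistanceBalanced G → ∀ {x y} → A x y ≡ true → transmission x ≡ transmission y
  balanced⇒transmission-edge balanced {x} {y} xy =
    +-cancelʳ-≡ (Wcard A x y) _ _ (trans (transmission+Wcard xy) (cong (transmission y +_) (sym (balanced x y xy))))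

  transmission-edge⇒balanced : (∀ {x y} → A x y ≡ true → transmission x ≡ transmission y) → DistanceBalanced G
  transmission-edge⇒balanced Tr-edge x y xy =
    +-cancelˡ-≡ (transmission x) _ _ (trans (transmission+Wcard xy) (cong (_+ Wcard A y x) (sym (Tr-edge xy))))

  balanced⇒transmission-walk : DistanceBalanced G → ∀ k u v → within A k u v ≡ true → transmission u ≡ transmission v
  balanced⇒transmission-walk balanced zero    u v uv rewrite within-zero⁻ A u v uv = refl
  balanced⇒transmission-walk balanced (suc k) u v uv with within-suc⁻ A k u v uv
  ... | inj₁ uv′           = balanced⇒transmission-walk balanced k u v uv′
  ... | inj₂ (w , uw , wv) = trans (balanced⇒transmission-edge balanced uw) (balanced⇒transmission-walk balanced k w v wv)

  private
    weight : Fin n → Fin n → ℕ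
    weight v u = dist A u v + 𝟙 (A v u) + (δ u v + δ u v)

    ∑-weight : ∀ v → ∑[ u < n ] weight v u ≡ transmission v + degree A v + 2
    ∑-weight v = begin
      ∑[ u < n ] weight v u
        ≡⟨ ∑-distrib-+ (λ u → dist A u v + 𝟙 (A v u)) _ ⟩
      ∑[ u < n ] (dist A u v + 𝟙 (A v u)) + ∑[ u < n ] (δ u v + δ u v)
        ≡⟨ cong₂ _+_ (∑-distrib-+ (λ u → dist A u v) _) (∑-distrib-+ (λ u → δ u v) _) ⟩
      transmission v + ∑[ u < n ] 𝟙 (A v u) + (∑[ u < n ] δ u v + ∑[ u < n ] δ u v)
        ≡⟨ cong₂ (λ d s → transmission v + d + (s + s)) (sym (degree-∑ A v)) (∑-δ v) ⟩
      transmission v + degree A v + 2 ∎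
      where open ≡-Reasoning

    weight-≥ : 2 ≤ n → ∀ v u → 2 ≤ weight v u
    weight-≥ 2≤n v u with u Fin.≟ v
    ... | yes refl = m≤n+m 2 _
    ... | no  u≢v rewrite +-identityʳ (dist A u v + 𝟙 (A v u)) with dist A u v in d
    ...   | zero        = ⊥-elim (u≢v (dist≡0⇒≡ A d))
    ...   | suc zero    rewrite Graph.sym G v u | dist≡1⇒adj A 2≤n d = ≤-refl
    ...   | suc (suc _) = s≤s (s≤s z≤n)

    weight-≤ : 2 ≤ n → ∀ v u → dist A u v ≤ 2 → weight v u ≤ 2
    weight-≤ 2≤n v u d≤2 with u Fin.≟ v
    ... | yes refl rewrite dist-refl A u | Graph.irrefl G u = ≤-refl
    ... | no  u≢v rewrite +-identityʳ (dist A u v + 𝟙 (A v u)) with dist A u v in d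
    ...   | zero           = ⊥-elim (u≢v (dist≡0⇒≡ A d))
    ...   | suc zero       rewrite Graph.sym G v u | dist≡1⇒adj A 2≤n d = ≤-refl
    ...   | suc (suc zero) with A v u in vu
    ...     | false = ≤-refl
    ...     | true  = ⊥-elim (<⇒≱ (≤-reflexive (sym d)) (dist-≤ A 1 u v (within-edge A u v uv)))
      where
      uv : A u v ≡ true
      uv = trans (Graph.sym G u v) vu
    weight-≤ 2≤n v u (s≤s (s≤s ())) | no _ | suc (suc (suc _))

  transmission+degree-≥ : 2 ≤ n → ∀ v → n * 2 ≤ transmission v + degree A v + 2
  transmission+degree-≥ 2≤n v =
    subst₂ _≤_ (∑-const n 2) (∑-weight v) (∑-mono-≤ (weight-≥ 2≤n v))

  transmission+degree-≤ : 2 ≤ n → ∀ v → (∀ u → dist A u v ≤ 2) → transmission v + degree A v + 2 ≤ n * 2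
  transmission+degree-≤ 2≤n v ecc≤2 =
    subst₂ _≤_ (∑-weight v) (∑-const n 2) (∑-mono-≤ (λ u → weight-≤ 2≤n v u (ecc≤2 u)))

  eccentricity≤2⇒transmission+degree-minimal : 2 ≤ n → ∀ {x} → (∀ u → dist A u x ≤ 2) →
    ∀ y → transmission x + degree A x ≤ transmission y + degree A y
  eccentricity≤2⇒transmission+degree-minimal 2≤n {x} ecc≤2 y = +-cancelʳ-≤ 2 _ _
    (≤-trans (transmission+degree-≤ 2≤n x ecc≤2) (transmission+degree-≥ 2≤n y))

  far⇒degree-sum-≤ : ∀ {u v} → within A 2 u v ≡ false → degree A u + degree A v + 2 ≤ n
  far⇒degree-sum-≤ {u} {v} far = subst₂ _≤_ ∑-count (∑-1 n) (∑-mono-≤ disjoint)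
    where
    near : within A 2 u v ≡ true → ⊥
    near uv = true≢false uv far

    -- {u}, {v}, N(u) and N(v) are pairwise disjoint as d(u,v) > 2
    disjoint : ∀ w → 𝟙 (A u w) + 𝟙 (A v w) + (δ w u + δ w v) ≤ 1
    disjoint w with A u w in uw | A v w in vw | w Fin.≟ u | w Fin.≟ v
    ... | true  | true  | _        | _        =
      ⊥-elim (near (within-step A 1 u w v uw (within-edge A w v (trans (Graph.sym G w v) vw))))
    ... | true  | false | yes refl | _        = ⊥-elim (true≢false uw (Graph.irrefl G w))
    ... | true  | false | no _     | yes refl =
      ⊥-elim (near (within-weaken A 1 u w (within-edge A u w uw)))
    ... | true  | false | no _     | no _     = ≤-refl
    ... | false | true  | yes refl | _        =
      ⊥-elim (near (within-weaken A 1 w v (within-edge A w v (trans (Graph.sym G w v) vw))))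
    ... | false | true  | no _     | yes refl = ⊥-elim (true≢false vw (Graph.irrefl G w))
    ... | false | true  | no _     | no _     = ≤-refl
    ... | false | false | yes refl | yes refl =
      ⊥-elim (near (within-weaken A 1 w w (within-weaken A 0 w w (within-refl A w))))
    ... | false | false | yes _    | no _     = ≤-refl
    ... | false | false | no _     | yes _    = ≤-refl
    ... | false | false | no _     | no _     = z≤n

    ∑-count : ∑[ w < n ] (𝟙 (A u w) + 𝟙 (A v w) + (δ w u + δ w v)) ≡ degree A u + degree A v + 2
    ∑-count = begin
      ∑[ w < n ] (𝟙 (A u w) + 𝟙 (A v w) + (δ w u + δ w v))
        ≡⟨ ∑-distrib-+ (λ w → 𝟙 (A u w) + 𝟙 (A v w)) _ ⟩
      ∑[ w < n ] (𝟙 (A u w) + 𝟙 (A v w)) + ∑[ w < n ] (δ w u + δ w v)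
        ≡⟨ cong₂ _+_ (∑-distrib-+ (λ w → 𝟙 (A u w)) _) (∑-distrib-+ (λ w → δ w u) _) ⟩
      ∑[ w < n ] 𝟙 (A u w) + ∑[ w < n ] 𝟙 (A v w) + (∑[ w < n ] δ w u + ∑[ w < n ] δ w v)
        ≡⟨ cong₂ _+_ (cong₂ _+_ (sym (degree-∑ A u)) (sym (degree-∑ A v))) (cong₂ _+_ (∑-δ u) (∑-δ v)) ⟩
      degree A u + degree A v + 2 ∎
      where open ≡-Reasoning

  minDegree⇒diam≤2 : ∀ d → (∀ v → d ≤ degree A v) → n < d + d + 2 → DiamAtMost G 2
  minDegree⇒diam≤2 d d≤deg n<2d+2 u v with within A 2 u v in uv
  ... | true  = dist-≤ A 2 u v uv
  ... | false = ⊥-elim (<⇒≱ n<2d+2 (≤-trans (+-monoˡ-≤ 2 (+-mono-≤ (d≤deg u) (d≤deg v))) (far⇒degree-sum-≤ uv)))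

  diam≤2-regular⇒balanced : 2 ≤ n → DiamAtMost G 2 → Regular G → DistanceBalanced G
  diam≤2-regular⇒balanced 2≤n diam≤2 (r , deg≡r) = transmission-edge⇒balanced Tr-edge
    where
    Tr-≤ : ∀ x y → transmission x ≤ transmission y
    Tr-≤ x y = +-cancelʳ-≤ r _ _ (subst₂ (λ a b → transmission x + a ≤ transmission y + b) (deg≡r x) (deg≡r y)
                 (eccentricity≤2⇒transmission+degree-minimal 2≤n (λ u → diam≤2 u x) y))

    Tr-edge : ∀ {x y} → A x y ≡ true → transmission x ≡ transmission y
    Tr-edge {x} {y} _ = ≤-antisym (Tr-≤ x y) (Tr-≤ y x)

  balanced-centred⇒diam≤2×regular : 2 ≤ n → DistanceBalanced G →
    ∀ o → (∀ u → within A 2 u o ≡ true) → n < degree A o + degree A o + 2 →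
    DiamAtMost G 2 × Regular G
  balanced-centred⇒diam≤2×regular 2≤n balanced o centre n<2d+2 = diam≤2 , degree A o , deg≡deg-o
    where
    Tr≡Tr-o : ∀ v → transmission v ≡ transmission o
    Tr≡Tr-o v = balanced⇒transmission-walk balanced 2 v o (centre v)

    degree-≤ : ∀ x → (∀ u → dist A u x ≤ 2) → ∀ y → transmission x ≡ transmission y → degree A x ≤ degree A y
    degree-≤ x ecc≤2 y Trx≡Try = +-cancelˡ-≤ (transmission x) _ _
      (subst (λ t → transmission x + degree A x ≤ t + degree A y) (sym Trx≡Try)
        (eccentricity≤2⇒transmission+degree-minimal 2≤n ecc≤2 y))

    degree-o-≤ : ∀ v → degree A o ≤ degree A v
    degree-o-≤ v = degree-≤ o (λ u → dist-≤ A 2 u o (centre u)) v (sym (Tr≡Tr-o v))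

    diam≤2 : DiamAtMost G 2
    diam≤2 = minDegree⇒diam≤2 (degree A o) degree-o-≤ n<2d+2

    deg≡deg-o : ∀ v → degree A v ≡ degree A o
    deg≡deg-o v = ≤-antisym (degree-≤ v (λ u → diam≤2 u v) o (Tr≡Tr-o v)) (degree-o-≤ v)

  ∑-degree : ∑[ v < n ] degree A v ≡ edgeCount A * 2
  ∑-degree = begin
    ∑[ u < n ] degree A u
      ≡⟨ sum-cong-≗ (λ u → trans (degree-∑ A u) (sum-cong-≗ (𝟙-adj-split u))) ⟩
    ∑[ u < n ] ∑[ v < n ] (E u v + E v u)
      ≡⟨ sum-cong-≗ (λ u → ∑-distrib-+ (E u) (λ v → E v u)) ⟩
    ∑[ u < n ] (∑[ v < n ] E u v + ∑[ v < n ] E v u)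
      ≡⟨ ∑-distrib-+ (λ u → ∑[ v < n ] E u v) _ ⟩
    ∑[ u < n ] ∑[ v < n ] E u v + ∑[ u < n ] ∑[ v < n ] E v u
      ≡⟨ cong (∑[ u < n ] ∑[ v < n ] E u v +_) (∑-comm (λ u v → E v u)) ⟩
    ∑[ u < n ] ∑[ v < n ] E u v + ∑[ u < n ] ∑[ v < n ] E u v
      ≡⟨ cong (λ e → e + e) (sym (edgeCount-∑ A)) ⟩
    edgeCount A + edgeCount A
      ≡⟨ +-double (edgeCount A) ⟩
    edgeCount A * 2 ∎
    where
    open ≡-Reasoning
    E : Fin n → Fin n → ℕ
    E u v = 𝟙 ((toℕ u <ᵇ toℕ v) ∧ A u v)

    𝟙-adj-split : ∀ u v → 𝟙 (A u v) ≡ E u v + E v u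
    𝟙-adj-split u v with toℕ u <ᵇ toℕ v | <ᵇ-reflects-< (toℕ u) (toℕ v) | toℕ v <ᵇ toℕ u | <ᵇ-reflects-< (toℕ v) (toℕ u)
    ... | true  | ofʸ u<v | true  | ofʸ v<u = ⊥-elim (<-asym u<v v<u)
    ... | true  | _       | false | _       = sym (+-identityʳ _)
    ... | false | _       | true  | _       = cong 𝟙 (Graph.sym G u v)
    ... | false | ofⁿ u≮v | false | ofⁿ v≮u with toℕ-injective (≤-antisym (≮⇒≥ v≮u) (≮⇒≥ u≮v))
    ...   | refl rewrite Graph.irrefl G u = refl

  minDegree⇒edgeCount : ∀ d → (∀ v → d ≤ degree A v) → n * d ≤ edgeCount A * 2
  minDegree⇒edgeCount d d≤deg = subst₂ _≤_ (∑-const n d) ∑-degree (∑-mono-≤ d≤deg)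

  regular⇒edgeCount : ∀ r → (∀ v → degree A v ≡ r) → edgeCount A * 2 ≡ n * r
  regular⇒edgeCount r deg≡r = trans (sym ∑-degree) (trans (sum-cong-≗ deg≡r) (∑-const n r))

2≤m+3 : ∀ {m} → 2 ≤ m + 3
2≤m+3 {m} = ≤-trans (n≤1+n 2) (m≤n+m 3 m)

m+3<m+m+2 : ∀ {m} → 2 < m → m + 3 < m + m + 2
m+3<m+m+2 {m} 2<m = subst (m + 3 <_) (sym (+-assoc m m 2)) (+-monoʳ-< m (+-monoˡ-≤ 2 (<⇒≤ 2<m)))

triangular : ℕ → ℕ
triangular zero    = 0
triangular (suc n) = suc n + triangular n

triangular-double : ∀ n → n * n + n ≡ triangular n * 2
triangular-double zero    = refl
triangular-double (suc n) = begin
  suc n * suc n + suc n            ≡⟨ solve (n ∷ []) ⟩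
  (n * n + n) + suc n * 2          ≡⟨ cong (_+ suc n * 2) (triangular-double n) ⟩
  triangular n * 2 + suc n * 2     ≡⟨ +-comm (triangular n * 2) (suc n * 2) ⟩
  suc n * 2 + triangular n * 2     ≡⟨ *-distribʳ-+ 2 (suc n) (triangular n) ⟨
  (suc n + triangular n) * 2       ∎
  where open ≡-Reasoning

n≤triangular : ∀ n → n ≤ triangular n
n≤triangular zero    = z≤n
n≤triangular (suc n) = m≤m+n (suc n) (triangular n)

balance-number-double : ∀ m → 2 ≤ m → (m + 2 + (m * m + m ∸ 4) / 2) * 2 ≡ (m + 3) * m
balance-number-double m 2≤m = begin
  (m + 2 + (m * m + m ∸ 4) / 2) * 2   ≡⟨ cong (λ h → (m + 2 + h) * 2) half ⟩
  (m + 2 + (t ∸ 2)) * 2               ≡⟨ cong (_* 2) (trans (+-assoc m 2 (t ∸ 2)) (cong (m +_) (m+[n∸m]≡n 2≤t))) ⟩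
  (m + t) * 2                         ≡⟨ *-distribʳ-+ 2 m t ⟩
  m * 2 + t * 2                       ≡⟨ cong (m * 2 +_) (triangular-double m) ⟨
  m * 2 + (m * m + m)                 ≡⟨ solve (m ∷ []) ⟩
  (m + 3) * m                         ∎
  where
  open ≡-Reasoning
  t : ℕ
  t = triangular m

  2≤t : 2 ≤ t
  2≤t = ≤-trans 2≤m (n≤triangular m)

  half : (m * m + m ∸ 4) / 2 ≡ t ∸ 2
  half = begin
    (m * m + m ∸ 4) / 2   ≡⟨ cong (λ s → (s ∸ 4) / 2) (triangular-double m) ⟩
    (t * 2 ∸ 2 * 2) / 2   ≡⟨ cong (_/ 2) (*-distribʳ-∸ 2 t 2) ⟨
    (t ∸ 2) * 2 / 2       ≡⟨ m*n/n≡m (t ∸ 2) 2 ⟩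
    t ∸ 2                 ∎

module Tree (m : ℕ) (0<m : 0 < m) where

  o x₁ : Fin (m + 3)
  o  = Fin.fromℕ< {0} (≤-trans 0<m (m≤m+n m 3))
  x₁ = Fin.fromℕ< {3} (m<n+m 3 0<m)

  private
    tree : Adj (m + 3)
    tree = treeAdj m

    o≡ : toℕ o ≡ 0
    o≡ = toℕ-fromℕ< _

    x₁≡ : toℕ x₁ ≡ 3
    x₁≡ = toℕ-fromℕ< _

  tree-edge : ∀ {u v a b} → toℕ u ≡ a → toℕ v ≡ b → treeEdge a b ∨ treeEdge b a ≡ true → tree u v ≡ true
  tree-edge refl refl ab = ab

  tree-centre : ∀ u → within tree 2 u o ≡ true
  tree-centre u = centre (toℕ u) refl
    where
    via-x₁ : tree u x₁ ≡ true → within tree 2 u o ≡ true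
    via-x₁ ux₁ = within-step tree 1 u x₁ o ux₁ (within-edge tree x₁ o (tree-edge x₁≡ o≡ refl))

    centre : ∀ a → toℕ u ≡ a → within tree 2 u o ≡ true
    centre 0 u≡ rewrite toℕ-injective (trans u≡ (sym o≡)) =
      within-weaken tree 1 o o (within-weaken tree 0 o o (within-refl tree o))
    centre 1 u≡ = via-x₁ (tree-edge u≡ x₁≡ refl)
    centre 2 u≡ = via-x₁ (tree-edge u≡ x₁≡ refl)
    centre (suc (suc (suc _))) u≡ =
      within-weaken tree 1 u o (within-edge tree u o (tree-edge u≡ o≡ (∨-zeroʳ _)))

  tree-degree-o : degree tree o ≡ m
  tree-degree-o = begin
    degree tree o
      ≡⟨ degree-∑ tree o ⟩
    ∑[ w < m + 3 ] 𝟙 (treeEdge (toℕ o) (toℕ w) ∨ treeEdge (toℕ w) (toℕ o))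
      ≡⟨ sum-cong-≗ {m + 3} (λ w → cong (λ a → 𝟙 (treeEdge a (toℕ w) ∨ treeEdge (toℕ w) a)) o≡) ⟩
    ∑[ w < m + 3 ] 𝟙 (treeEdge 0 (toℕ w) ∨ treeEdge (toℕ w) 0)
      ≡⟨ ∑-split3 m (λ b → 𝟙 (treeEdge 0 b ∨ treeEdge b 0)) ⟩
    ∑[ i < m ] 1
      ≡⟨ ∑-1 m ⟩
    m ∎
    where open ≡-Reasoning

  spanning-centre : ∀ (H : Graph (m + 3)) → SpanningSuper tree H → ∀ u → within (adj H) 2 u o ≡ true
  spanning-centre H tree⊆H u = within-⊆ tree (adj H) tree⊆H 2 u o (tree-centre u)

  spanning-degree-o : ∀ (H : Graph (m + 3)) → SpanningSuper tree H → m ≤ degree (adj H) o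
  spanning-degree-o H tree⊆H = subst (_≤ degree (adj H) o) tree-degree-o (degree-⊆ tree (adj H) tree⊆H o)

  tree-edgeCount : edgeCount tree ≡ m + 2
  tree-edgeCount = begin
    edgeCount tree
      ≡⟨ edgeCount-∑ tree ⟩
    ∑[ u < m + 3 ] row (toℕ u)
      ≡⟨ ∑-split3 m row ⟩
    row 0 + (row 1 + (row 2 + ∑[ i < m ] row (3 + toℕ i)))
      ≡⟨ cong₂ _+_ row-o (cong₂ _+_ row-y (cong₂ _+_ row-z (∑-zero m (λ i → row-x (toℕ i))))) ⟩
    m + 2 ∎
    where
    open ≡-Reasoning
    upper-edge : ℕ → ℕ → ℕ
    upper-edge a b = 𝟙 ((a <ᵇ b) ∧ (treeEdge a b ∨ treeEdge b a))

    row : ℕ → ℕ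
    row a = ∑[ j < m + 3 ] upper-edge a (toℕ j)

    row-o : row 0 ≡ m
    row-o = trans (∑-split3 m (upper-edge 0)) (∑-1 m)

    row-y : row 1 ≡ 1
    row-y = trans (∑-split3 m (upper-edge 1)) (trans (sum-cong-≗ {m} (λ i → cong 𝟙 (∧-identityʳ (toℕ i ≡ᵇ 0)))) (∑-𝟙-≡ᵇ 0<m))

    row-z : row 2 ≡ 1
    row-z = trans (∑-split3 m (upper-edge 2)) (trans (sum-cong-≗ {m} (λ i → cong 𝟙 (∧-identityʳ (toℕ i ≡ᵇ 0)))) (∑-𝟙-≡ᵇ 0<m))

    row-x : ∀ a → row (3 + a) ≡ 0
    row-x a = trans (∑-split3 m (upper-edge (3 + a))) (∑-zero m no-edge)
      where
      no-edge : ∀ i → 𝟙 ((a <ᵇ toℕ i) ∧ (((a ≡ᵇ 0) ∧ false) ∨ ((toℕ i ≡ᵇ 0) ∧ false))) ≡ 0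
      no-edge i rewrite ∧-zeroʳ (a ≡ᵇ 0) | ∧-zeroʳ (toℕ i ≡ᵇ 0) | ∧-zeroʳ (a <ᵇ toℕ i) = refl

-- Vertex 3 + i is x_{i+1}, and next/prev walk around the cycle 0, 1, …, m - 1 of positions.
-- Two x's are adjacent unless equal or consecutive on the cycle; o, y, z are adjacent exactly to the x's.
module Construction (m : ℕ) (3≤m : 3 ≤ m) where

  next : ℕ → ℕ
  next i = if does (suc i ≟ m) then 0 else suc i

  prev : ℕ → ℕ
  prev zero    = pred m
  prev (suc i) = i

  next-wrap : ∀ {i} → suc i ≡ m → next i ≡ 0
  next-wrap {i} 1+i≡m = cong (λ b → if b then 0 else suc i) (dec-true (suc i ≟ m) 1+i≡m)

  next-step : ∀ {i} → suc i ≢ m → next i ≡ suc i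
  next-step {i} 1+i≢m = cong (λ b → if b then 0 else suc i) (dec-false (suc i ≟ m) 1+i≢m)

  xAdj : ℕ → ℕ → Bool
  xAdj i j = not (does (i ≟ j) ∨ (does (j ≟ next i) ∨ does (i ≟ next j)))

  isX : ℕ → Bool
  isX a = 3 ≤ᵇ a

  extremalAdj : ℕ → ℕ → Bool
  extremalAdj a b = if isX a ∧ isX b then xAdj (a ∸ 3) (b ∸ 3) else isX a ∨ isX b

  xAdj-sym : ∀ i j → xAdj i j ≡ xAdj j i
  xAdj-sym i j = cong not (cong₂ _∨_ (does-⇔ (mk⇔ sym sym) (i ≟ j) (j ≟ i)) (∨-comm (does (j ≟ next i)) _))

  extremalAdj-sym : ∀ a b → extremalAdj a b ≡ extremalAdj b a
  extremalAdj-sym a b rewrite ∧-comm (isX a) (isX b) | ∨-comm (isX a) (isX b) | xAdj-sym (a ∸ 3) (b ∸ 3) = refl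

  extremalAdj-irrefl : ∀ a → extremalAdj a a ≡ false
  extremalAdj-irrefl 0                   = refl
  extremalAdj-irrefl 1                   = refl
  extremalAdj-irrefl 2                   = refl
  extremalAdj-irrefl (suc (suc (suc i))) = cong (λ b → not (b ∨ (does (i ≟ next i) ∨ does (i ≟ next i)))) (dec-true (i ≟ i) refl)

  private
    suc-pred-m : suc (pred m) ≡ m
    suc-pred-m = suc-pred m {{>-nonZero (≤-trans (s≤s z≤n) 3≤m)}}

    m≢2 : m ≢ 2
    m≢2 m≡2 = <⇒≱ 3≤m (≤-reflexive m≡2)

    m≢1 : m ≢ 1
    m≢1 m≡1 = <⇒≱ 3≤m (≤-trans (≤-reflexive m≡1) (n≤1+n 1))

  next-< : ∀ {i} → i < m → next i < m
  next-< {i} i<m with suc i ≟ m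
  ... | yes 1+i≡m rewrite next-wrap 1+i≡m = ≤-trans (s≤s z≤n) i<m
  ... | no  1+i≢m rewrite next-step 1+i≢m = ≤∧≢⇒< i<m 1+i≢m

  prev-< : ∀ {i} → i < m → prev i < m
  prev-< {zero}  _   = ≤-reflexive suc-pred-m
  prev-< {suc i} i<m = <-trans (n<1+n i) i<m

  prev-next : ∀ {i} → i < m → prev (next i) ≡ i
  prev-next {i} i<m with suc i ≟ m
  ... | yes 1+i≡m rewrite next-wrap 1+i≡m = cong pred (sym 1+i≡m)
  ... | no  1+i≢m rewrite next-step 1+i≢m = refl

  next-prev : ∀ {i} → i < m → next (prev i) ≡ i
  next-prev {zero}  _   = next-wrap suc-pred-m
  next-prev {suc i} i<m = next-step (<⇒≢ i<m)

  next≢id : ∀ {i} → i < m → next i ≢ i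
  next≢id {i} i<m with suc i ≟ m
  ... | yes 1+i≡m rewrite next-wrap 1+i≡m = λ 0≡i → m≢1 (trans (sym 1+i≡m) (cong suc (sym 0≡i)))
  ... | no  1+i≢m rewrite next-step 1+i≢m = λ 1+i≡i → <-irrefl (sym 1+i≡i) (n<1+n i)

  prev≢id : ∀ {i} → i < m → prev i ≢ i
  prev≢id i<m p≡i = next≢id i<m (trans (sym (cong next p≡i)) (next-prev i<m))

  -- false for m = 2: the one place where m ≥ 3 is needed
  next≢prev : ∀ {i} → i < m → next i ≢ prev i
  next≢prev {zero} _ with 1 ≟ m
  ... | yes 1≡m = λ _ → m≢1 (sym 1≡m)
  ... | no  1≢m rewrite next-step 1≢m = λ 1≡pm → m≢2 (trans (sym suc-pred-m) (cong suc (sym 1≡pm)))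
  next≢prev {suc j} _ with suc (suc j) ≟ m
  ... | yes 2+j≡m rewrite next-wrap 2+j≡m = λ 0≡j → m≢2 (trans (sym 2+j≡m) (cong (λ k → suc (suc k)) (sym 0≡j)))
  ... | no  2+j≢m rewrite next-step 2+j≢m = λ 2+j≡j → <-irrefl (sym 2+j≡j) (n≤1+n (suc j))

  xAdj-partition : ∀ {i j} → i < m → j < m →
    𝟙 (xAdj i j) + (𝟙 (does (j ≟ i)) + 𝟙 (does (j ≟ next i)) + 𝟙 (does (j ≟ prev i))) ≡ 1
  xAdj-partition {i} {j} i<m j<m =
    subst (λ b → 𝟙 b + (𝟙 (does (j ≟ i)) + 𝟙 (does (j ≟ next i)) + 𝟙 (does (j ≟ prev i))) ≡ 1) (sym xAdj≡)
      (𝟙-partition (j ≟ i) (j ≟ next i) (j ≟ prev i)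
        (λ j≡i j≡ni → next≢id i<m (trans (sym j≡ni) j≡i))
        (λ j≡i j≡pi → prev≢id i<m (trans (sym j≡pi) j≡i))
        (λ j≡ni j≡pi → next≢prev i<m (trans (sym j≡ni) j≡pi)))
    where
    i≟nj≡j≟pi : does (i ≟ next j) ≡ does (j ≟ prev i)
    i≟nj≡j≟pi = does-⇔ (mk⇔ (λ i≡nj → trans (sym (prev-next j<m)) (cong prev (sym i≡nj)))
                             (λ j≡pi → trans (sym (next-prev i<m)) (cong next (sym j≡pi))))
                       (i ≟ next j) (j ≟ prev i)

    xAdj≡ : xAdj i j ≡ not (does (j ≟ i) ∨ (does (j ≟ next i) ∨ does (j ≟ prev i)))
    xAdj≡ = cong not (cong₂ (λ p r → p ∨ (does (j ≟ next i) ∨ r)) (does-⇔ (mk⇔ sym sym) (i ≟ j) (j ≟ i)) i≟nj≡j≟pi)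

  ∑-xAdj : ∀ {i} → i < m → ∑[ j < m ] 𝟙 (xAdj i (toℕ j)) + 3 ≡ m
  ∑-xAdj {i} i<m = begin
    ∑[ j < m ] 𝟙 (xAdj i (toℕ j)) + 3
      ≡⟨ cong (∑[ j < m ] 𝟙 (xAdj i (toℕ j)) +_) ∑-closed-neighbourhood ⟨
    ∑[ j < m ] 𝟙 (xAdj i (toℕ j)) + ∑[ j < m ] closed-neighbour j
      ≡⟨ ∑-distrib-+ (λ j → 𝟙 (xAdj i (toℕ j))) closed-neighbour ⟨
    ∑[ j < m ] (𝟙 (xAdj i (toℕ j)) + closed-neighbour j)
      ≡⟨ sum-cong-≗ {m} (λ j → xAdj-partition i<m (toℕ<n j)) ⟩
    ∑[ j < m ] 1
      ≡⟨ ∑-1 m ⟩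
    m ∎
    where
    open ≡-Reasoning
    is : ℕ → Fin m → ℕ
    is k j = 𝟙 (does (toℕ j ≟ k))

    closed-neighbour : Fin m → ℕ
    closed-neighbour j = is i j + is (next i) j + is (prev i) j

    ∑-closed-neighbourhood : ∑[ j < m ] closed-neighbour j ≡ 3
    ∑-closed-neighbourhood =
      trans (∑-distrib-+ (λ j → is i j + is (next i) j) (is (prev i)))
        (cong₂ _+_ (trans (∑-distrib-+ (is i) (is (next i))) (cong₂ _+_ (∑-𝟙-≡ᵇ i<m) (∑-𝟙-≡ᵇ (next-< i<m))))
                   (∑-𝟙-≡ᵇ (prev-< i<m)))

  extremalAdj-row : ∀ a → a < m + 3 → ∑[ b < m + 3 ] 𝟙 (extremalAdj a (toℕ b)) ≡ m
  extremalAdj-row 0 _ = trans (∑-split3 m (λ b → 𝟙 (extremalAdj 0 b))) (∑-1 m)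
  extremalAdj-row 1 _ = trans (∑-split3 m (λ b → 𝟙 (extremalAdj 1 b))) (∑-1 m)
  extremalAdj-row 2 _ = trans (∑-split3 m (λ b → 𝟙 (extremalAdj 2 b))) (∑-1 m)
  extremalAdj-row (suc (suc (suc i))) 3+i<m+3 =
    trans (∑-split3 m (λ b → 𝟙 (extremalAdj (3 + i) b))) (trans (+-comm 3 _) (∑-xAdj i<m))
    where
    i<m : i < m
    i<m = +-cancelʳ-< 3 i m (subst (_< m + 3) (+-comm 3 i) 3+i<m+3)

  treeEdge⇒extremalAdj : ∀ a b → treeEdge a b ≡ true → extremalAdj a b ≡ true
  treeEdge⇒extremalAdj 0 b 0b = trans (sym (∨-identityʳ (3 ≤ᵇ b))) 0b
  treeEdge⇒extremalAdj 3 1 _ = refl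
  treeEdge⇒extremalAdj 3 2 _ = refl
  treeEdge⇒extremalAdj 3 0 ()
  treeEdge⇒extremalAdj 3 (suc (suc (suc _))) ()
  treeEdge⇒extremalAdj 1 _ ()
  treeEdge⇒extremalAdj 2 _ ()
  treeEdge⇒extremalAdj (suc (suc (suc (suc _)))) _ ()

  extremal : Graph (m + 3)
  extremal = record
    { adj    = λ u v → extremalAdj (toℕ u) (toℕ v)
    ; sym    = λ u v → extremalAdj-sym (toℕ u) (toℕ v)
    ; irrefl = λ u → extremalAdj-irrefl (toℕ u)
    }

  tree⊆extremal : SpanningSuper (treeAdj m) extremal
  tree⊆extremal u v uv with treeEdge (toℕ u) (toℕ v) in e
  ... | true  = treeEdge⇒extremalAdj (toℕ u) (toℕ v) e
  ... | false = trans (extremalAdj-sym (toℕ u) (toℕ v)) (treeEdge⇒extremalAdj (toℕ v) (toℕ u) uv)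

  extremal-degree : ∀ v → degree (adj extremal) v ≡ m
  extremal-degree v = trans (degree-∑ (adj extremal) v) (extremalAdj-row (toℕ v) (toℕ<n v))

  extremal-balanced : DistanceBalanced extremal
  extremal-balanced = diam≤2-regular⇒balanced extremal 2≤m+3
    (minDegree⇒diam≤2 extremal m (λ v → ≤-reflexive (sym (extremal-degree v))) (m+3<m+m+2 3≤m)) (m , extremal-degree)

  extremal-edgeCount : edgeCount (adj extremal) * 2 ≡ (m + 3) * m
  extremal-edgeCount = regular⇒edgeCount extremal m extremal-degree

theorem4p3 : (m : ℕ) → 3 ≤ m →
    ((H : Graph (m + 3)) → SpanningSuper (treeAdj m) H → DistanceBalanced H →
    DiamAtMost H 2 × Regular H)
    × BalanceNumberIs (treeAdj m) ((m * m + m ∸ 4) / 2)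
theorem4p3 m 3≤m = diam≤2×regular , (extremal , tree⊆extremal , extremal-balanced , extremal-edges) , edges-≥
  where
  open Tree m (≤-trans (s≤s z≤n) 3≤m)
  open Construction m 3≤m

  b : ℕ
  b = (m * m + m ∸ 4) / 2

  double-edges : (edgeCount (treeAdj m) + b) * 2 ≡ (m + 3) * m
  double-edges = trans (cong (λ e → (e + b) * 2) tree-edgeCount) (balance-number-double m (<⇒≤ 3≤m))

  diam≤2×regular : ∀ H → SpanningSuper (treeAdj m) H → DistanceBalanced H → DiamAtMost H 2 × Regular H
  diam≤2×regular H tree⊆H balanced = balanced-centred⇒diam≤2×regular H 2≤m+3 balanced o (spanning-centre H tree⊆H)
    (≤-trans (m+3<m+m+2 3≤m) (+-monoˡ-≤ 2 (+-mono-≤ (spanning-degree-o H tree⊆H) (spanning-degree-o H tree⊆H))))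

  edges-≥ : ∀ H → SpanningSuper (treeAdj m) H → DistanceBalanced H → edgeCount (treeAdj m) + b ≤ edgeCount (adj H)
  edges-≥ H tree⊆H balanced with diam≤2×regular H tree⊆H balanced
  ... | _ , r , deg≡r = *-cancelʳ-≤ _ _ 2 (subst (_≤ edgeCount (adj H) * 2) (sym double-edges)
    (minDegree⇒edgeCount H m (λ v → subst (m ≤_) (trans (deg≡r o) (sym (deg≡r v))) (spanning-degree-o H tree⊆H))))

  extremal-edges : edgeCount (adj extremal) ≡ edgeCount (treeAdj m) + b
  extremal-edges = *-cancelʳ-≡ _ _ 2 (trans extremal-edgeCount (sym double-edges))
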